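{- Let $r \geqslant 2$, $t \geqslant 1$ and $n \geqslant 1$ be integers, and let $G$ be a graph on $rn + (r+1)t$ vertices. Then every red-blue colouring of $E(G)$ either contains a red path with $n$ edges, or there exist $r+1$ pairwise disjoint sets $A_1, \ldots, A_{r+1} \subset V(G)$ with $|A_1| = \cdots = |A_{r+1}| = t$ such that for each $1 \leqslant i < j \leqslant r+1$, every edge of $G$ between $A_i$ and $A_j$ is coloured blue. -}

module Defs where

open import Data.Nat using (ℕ; suc)
open import Data.Fin using (Fin; _<_; inject₁) renaming (suc to fsuc)
open import Data.Bool using (Bool; true; false)
open import Data.Product using (Σ; _×_; _,_)
open import Function.Definitions using (Injective)
open import Relation.Binary.PropositionalEquality using (_≡_)

record Graph (N : ℕ) : Set where
  field
    adj     : Fin N → Fin N → Bool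
    adj-sym : ∀ u v → adj u v ≡ adj v u
    irrefl  : ∀ v → adj v v ≡ false

data Colour : Set where
  red blue : Colour

-- A red-blue colouring of E(G): a symmetric assignment of colours to pairs of
-- vertices; only its values on edges of G are ever consulted.
record Colouring {N : ℕ} (G : Graph N) : Set where
  field
    col     : Fin N → Fin N → Colour
    col-sym : ∀ u v → col u v ≡ col v u

module _ {N : ℕ} (G : Graph N) (c : Colouring G) where
  open Graph G
  open Colouring c

  RedPath : ℕ → Set
  RedPath n = Σ (Fin (suc n) → Fin N) λ v →
    Injective _≡_ _≡_ v ×
    (∀ (i : Fin n) → adj (v (inject₁ i)) (v (fsuc i)) ≡ true
                   × col (v (inject₁ i)) (v (fsuc i)) ≡ red)

  -- k pairwise disjoint sets A_0,…,A_{k-1} of size t each, given by an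
  -- injective enumeration A (i , a) = a-th element of A_i, such that every edge
  -- of G between A_i and A_j (i < j) is blue.
  BlueSets : ℕ → ℕ → Set
  BlueSets k t = Σ (Fin k × Fin t → Fin N) λ A →
    Injective _≡_ _≡_ A ×
    (∀ (i j : Fin k) → i < j → ∀ (a b : Fin t) →
       adj (A (i , a)) (A (j , b)) ≡ true →
       col (A (i , a)) (A (j , b)) ≡ blue)

module Submission where

-- Let R be a symmetric
-- decidable relation ("red edge") on a vertex type.  Run a depth-first
-- search on a duplicate-free list L of vertices, keeping a partition
-- L ~ S ++ U ++ T into finished vertices S, a stack U that is an R-path,
-- and unvisited vertices T, with no R-edge between S and T.  Each move
-- either pushes an R-neighbour of the top of the stack (or any vertex of T
-- when the stack is empty), or pops the top into S; the potential
-- 2|T| + |U| strictly decreases.  If the stack ever reaches n + 1 vertices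
-- it is an R-path with n edges; otherwise we stop when |S| = t, and then
-- |T| ≥ |L| - t - n.  Iterating this split r times, each time continuing
-- inside T, gives r + 1 blocks of t vertices with no R-edge between
-- different blocks, provided |L| ≥ r n + (r + 1) t.

open import Defs
open import Data.Nat using (ℕ; zero; suc; _+_; _*_; _≤_; _<_; z≤n; s≤s; _≟_; _<?_)
open import Data.Sum as Sum using (_⊎_; inj₁; inj₂)
open import Data.Nat.Properties
  using (≤-reflexive; ≤-antisym; ≤-trans; ≮⇒≥; ≤∧≢⇒<; <-irrefl;
         +-suc; +-assoc; +-identityʳ; m≤m+n; n≤1+n; +-monoʳ-≤; +-monoˡ-≤; +-cancelˡ-≤;
         module ≤-Reasoning)
open import Data.Nat.Induction using (<-wellFounded)
open import Induction.WellFounded using (Acc; acc)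
open import Data.Nat.Tactic.RingSolver using (solve-∀)
open import Data.Fin as Fin using (Fin; inject≤; inject₁) renaming (zero to fzero; suc to fsuc)
open import Data.Fin.Properties using (inject≤-injective)
open import Data.Bool as Bool using (true)
open import Data.Product using (Σ; ∃₂; _×_; _,_)
open import Data.Empty using (⊥; ⊥-elim)
open import Data.List using (List; []; _∷_; _++_; length; lookup; allFin)
open import Data.List.Properties using (length-++; length-tabulate)
open import Data.List.Membership.Propositional using (_∈_)
open import Data.List.Membership.Propositional.Properties using (∈-lookup; ∈-++⁺ˡ; ∈-++⁺ʳ)
open import Data.List.Relation.Unary.Any as Any using (Any; here; there; any?)
import Data.List.Relation.Unary.All as All
import Data.List.Relation.Unary.All.Properties as All
open import Data.List.Relation.Unary.Linked using (Linked; []; [-]; _∷_)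
open import Data.List.Relation.Unary.Unique.Propositional using (Unique; []; _∷_)
open import Data.List.Relation.Unary.Unique.Propositional.Properties using (allFin⁺)
open import Data.List.Relation.Binary.Permutation.Propositional
  using (_↭_; ↭-refl; ↭-sym; ↭-trans; prep; swap; ↭⇒↭ₛ)
open import Data.List.Relation.Binary.Permutation.Propositional.Properties
  using (↭-length; ∈-resp-↭; ++⁺ˡ; shift; shifts)
open import Data.List.Relation.Binary.Permutation.Setoid.Properties using (Unique-resp-↭)
open import Function using (_∘_; id)
open import Function.Definitions using (Injective)
open import Relation.Nullary using (¬_; Dec; yes; no)
open import Relation.Nullary.Decidable using (_×-dec_)
open import Relation.Binary.PropositionalEquality
  using (_≡_; refl; sym; trans; cong; subst; setoid)

module RedPathOrBlueBlocks
  {V : Set} (R : V → V → Set) (R? : ∀ x y → Dec (R x y))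
  (R-sym : ∀ {x y} → R x y → R y x) where

  Path : ℕ → Set
  Path n = Σ (Fin (suc n) → V) λ v →
    Injective _≡_ _≡_ v × (∀ (i : Fin n) → R (v (inject₁ i)) (v (fsuc i)))

  Separated : List V → List V → Set
  Separated S T = ∀ {x y} → x ∈ S → y ∈ T → ¬ R x y

  unique-++⁻ˡ : ∀ {xs ys : List V} → Unique (xs ++ ys) → Unique xs
  unique-++⁻ˡ {[]}     _          = []
  unique-++⁻ˡ {x ∷ xs} (x∉ ∷ xs!) = All.++⁻ˡ xs x∉ ∷ unique-++⁻ˡ xs!

  unique-++⁻ʳ : ∀ (xs : List V) {ys} → Unique (xs ++ ys) → Unique ys
  unique-++⁻ʳ []       ys!       = ys!
  unique-++⁻ʳ (x ∷ xs) (_ ∷ xs!) = unique-++⁻ʳ xs xs!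

  unique-++-disjoint : ∀ {xs ys : List V} {v} → Unique (xs ++ ys) → v ∈ xs → v ∈ ys → ⊥
  unique-++-disjoint {x ∷ xs} (x∉ ∷ _)  (here refl) v∈ys = All.lookup (All.++⁻ʳ xs x∉) v∈ys refl
  unique-++-disjoint          (_ ∷ xs!) (there v∈xs) v∈ys = unique-++-disjoint xs! v∈xs v∈ys

  lookup-injective : ∀ {xs : List V} → Unique xs → Injective _≡_ _≡_ (lookup xs)
  lookup-injective (_  ∷ _)   {fzero}  {fzero}  _  = refl
  lookup-injective (x∉ ∷ _)   {fzero}  {fsuc j} eq = ⊥-elim (All.lookup x∉ (∈-lookup j) eq)
  lookup-injective (x∉ ∷ _)   {fsuc i} {fzero}  eq = ⊥-elim (All.lookup x∉ (∈-lookup i) (sym eq))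
  lookup-injective (_  ∷ xs!) {fsuc i} {fsuc j} eq = cong fsuc (lookup-injective xs! eq)

  enumerate : ∀ {xs : List V} {k} → Unique xs → k ≤ length xs →
    Σ (Fin k → V) λ f → Injective _≡_ _≡_ f × (∀ a → f a ∈ xs)
  enumerate {xs} xs! k≤ =
    (λ a → lookup xs (inject≤ a k≤)) ,
    (λ eq → inject≤-injective k≤ k≤ _ _ (lookup-injective xs! eq)) ,
    (λ a → ∈-lookup _)

  extract : ∀ {P : V → Set} {xs} → Any P xs → ∃₂ λ w ys → P w × xs ↭ w ∷ ys
  extract (here pw) = _ , _ , pw , ↭-refl
  extract {xs = x ∷ _} (there any) with extract any
  ... | w , ys , pw , xs↭ = w , x ∷ ys , pw , ↭-trans (prep x xs↭) (swap x w ↭-refl)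

  linked-lookup : ∀ {x xs} → Linked R (x ∷ xs) →
    ∀ (i : Fin (length xs)) → R (lookup (x ∷ xs) (inject₁ i)) (lookup (x ∷ xs) (fsuc i))
  linked-lookup (r ∷ _)      fzero    = r
  linked-lookup (_ ∷ linked) (fsuc i) = linked-lookup linked i

  linked-path : ∀ {x xs} → Unique (x ∷ xs) → Linked R (x ∷ xs) → Path (length xs)
  linked-path {x} {xs} unique linked =
    lookup (x ∷ xs) , lookup-injective unique , linked-lookup linked

  module Partition (S U T : List V) {L : List V} (perm : S ++ U ++ T ↭ L) (L! : Unique L) where

    SUT! : Unique (S ++ U ++ T)
    SUT! = Unique-resp-↭ (setoid V) (↭⇒↭ₛ (↭-sym perm)) L!

    S! : Unique S
    S! = unique-++⁻ˡ SUT!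

    U! : Unique U
    U! = unique-++⁻ˡ (unique-++⁻ʳ S SUT!)

    T! : Unique T
    T! = unique-++⁻ʳ U (unique-++⁻ʳ S SUT!)

    S∩T=∅ : ∀ {v} → v ∈ S → v ∈ T → ⊥
    S∩T=∅ v∈S v∈T = unique-++-disjoint SUT! v∈S (∈-++⁺ʳ U v∈T)

    S⊆L : ∀ {v} → v ∈ S → v ∈ L
    S⊆L v∈S = ∈-resp-↭ perm (∈-++⁺ˡ v∈S)

    T⊆L : ∀ {v} → v ∈ T → v ∈ L
    T⊆L v∈T = ∈-resp-↭ perm (∈-++⁺ʳ S (∈-++⁺ʳ U v∈T))

    sizes : length S + (length U + length T) ≡ length L
    sizes = trans (sym (trans (length-++ S) (cong (length S +_) (length-++ U)))) (↭-length perm)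

  Blocks : ℕ → ℕ → List V → Set
  Blocks k t L = Σ (Fin k × Fin t → V) λ A →
    Injective _≡_ _≡_ A × (∀ p → A p ∈ L) ×
    (∀ (i j : Fin k) → i Fin.< j → ∀ a b → ¬ R (A (i , a)) (A (j , b)))

  no-blocks : ∀ {t} → Blocks 0 t []
  no-blocks = (λ { (() , _) }) , (λ { {() , _} }) , (λ { (() , _) }) , λ ()

  extend : ∀ {k t L T} (s : Fin t → V) → Injective _≡_ _≡_ s → (∀ a → s a ∈ L) →
    (∀ {v} → v ∈ T → v ∈ L) → (∀ a → s a ∈ T → ⊥) → (∀ a {y} → y ∈ T → ¬ R (s a) y) →
    Blocks k t T → Blocks (suc k) t L
  extend {k} {t} {L} {T} s s-inj s∈L T⊆L s∉T s-sep (A , A-inj , A∈T , A-sep) =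
    A⁺ , A⁺-inj , A⁺∈L , A⁺-sep
    where
    A⁺ : Fin (suc k) × Fin t → V
    A⁺ (fzero  , a) = s a
    A⁺ (fsuc i , a) = A (i , a)

    A⁺-inj : Injective _≡_ _≡_ A⁺
    A⁺-inj {fzero  , a} {fzero  , b} eq = cong (fzero ,_) (s-inj eq)
    A⁺-inj {fzero  , a} {fsuc j , b} eq = ⊥-elim (s∉T a (subst (_∈ T) (sym eq) (A∈T (j , b))))
    A⁺-inj {fsuc i , a} {fzero  , b} eq = ⊥-elim (s∉T b (subst (_∈ T) eq (A∈T (i , a))))
    A⁺-inj {fsuc i , a} {fsuc j , b} eq with A-inj eq
    ... | refl = refl

    A⁺∈L : ∀ p → A⁺ p ∈ L
    A⁺∈L (fzero  , a) = s∈L a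
    A⁺∈L (fsuc i , a) = T⊆L (A∈T (i , a))

    A⁺-sep : ∀ (i j : Fin (suc k)) → i Fin.< j → ∀ a b → ¬ R (A⁺ (i , a)) (A⁺ (j , b))
    A⁺-sep fzero    (fsuc j) _         a b = s-sep a (A∈T (j , b))
    A⁺-sep (fsuc i) (fsuc j) (s≤s i<j) a b = A-sep i j i<j a b

  -- Moving one vertex from T (counted twice) to the stack lowers the potential.
  push-arithmetic : ∀ a b → suc (a + a + suc b) ≡ suc a + suc a + b
  push-arithmetic = solve-∀

  module DepthFirstSearch
    (L : List V) (L! : Unique L) (t n m : ℕ) (room : t + n + m ≤ length L) where

    record State : Set where
      constructor state
      field
        S U T   : List V
        perm    : S ++ U ++ T ↭ L
        stack   : Linked R U
        S-small : length S ≤ t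
        U-small : length U ≤ n
        sep     : Separated S T

    potential : State → ℕ
    potential st = length T + length T + length U where open State st

    record Split : Set where
      field
        S U T  : List V
        perm   : S ++ U ++ T ↭ L
        S-size : length S ≡ t
        T-size : m ≤ length T
        sep    : Separated S T

    -- Once S is full, T has lost at most t + n vertices of L.
    finish : (st : State) → length (State.S st) ≡ t → Split
    finish (state S U T perm _ _ U-small sep) S-size =
      record { S = S ; U = U ; T = T ; perm = perm ; S-size = S-size ; T-size = T-size ; sep = sep }
      where
      open ≤-Reasoning
      T-size : m ≤ length T
      T-size = +-cancelˡ-≤ (t + n) m (length T) (begin
        t + n + m                          ≤⟨ room ⟩
        length L                           ≡⟨ sym (Partition.sizes S U T perm L!) ⟩
        length S + (length U + length T)   ≡⟨ cong (_+ (length U + length T)) S-size ⟩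
        t + (length U + length T)          ≤⟨ +-monoʳ-≤ t (+-monoˡ-≤ (length T) U-small) ⟩
        t + (n + length T)                 ≡⟨ sym (+-assoc t n (length T)) ⟩
        t + n + length T                   ∎)

    push-perm : ∀ S U T w T′ → S ++ U ++ T ↭ L → T ↭ w ∷ T′ → S ++ (w ∷ U) ++ T′ ↭ L
    push-perm S U T w T′ perm T↭ =
      ↭-trans (++⁺ˡ S (↭-trans (shifts (w ∷ []) U) (++⁺ˡ U (↭-sym T↭)))) perm

    push : ∀ S U T w T′ → S ++ U ++ T ↭ L → T ↭ w ∷ T′ → Linked R (w ∷ U) →
      length S ≤ t → length U ≤ n → Separated S T →
      Path n ⊎ Σ State λ st′ → potential st′ < length T + length T + length U
    push S U T w T′ perm T↭ stack S-small U-small sep with length U <? n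
    ... | no U≮n = inj₁ (subst Path |U|≡n (linked-path wU! stack))
      where
      |U|≡n : length U ≡ n
      |U|≡n = ≤-antisym U-small (≮⇒≥ U≮n)
      wU! : Unique (w ∷ U)
      wU! = Partition.U! S (w ∷ U) T′ (push-perm S U T w T′ perm T↭) L!
    ... | yes U<n =
      inj₂ (state S (w ∷ U) T′ (push-perm S U T w T′ perm T↭) stack S-small U<n sep′ , decrease)
      where
      sep′ : Separated S T′
      sep′ x∈S y∈T′ = sep x∈S (∈-resp-↭ (↭-sym T↭) (there y∈T′))
      decrease : suc (length T′ + length T′ + suc (length U)) ≤ length T + length T + length U
      decrease = ≤-reflexive (trans (push-arithmetic (length T′) (length U))
                                    (cong (λ k → k + k + length U) (sym (↭-length T↭))))

    pop : ∀ S u U T → S ++ (u ∷ U) ++ T ↭ L → Linked R (u ∷ U) → length S < t →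
      length U ≤ n → Separated S T → (∀ {y} → y ∈ T → ¬ R u y) →
      Σ State λ st′ → potential st′ < length T + length T + suc (length U)
    pop S u U T perm stack S<t U-small sep u-done =
      state (u ∷ S) U T perm′ (tail stack) S<t U-small sep′ ,
      ≤-reflexive (sym (+-suc (length T + length T) (length U)))
      where
      perm′ : (u ∷ S) ++ U ++ T ↭ L
      perm′ = ↭-trans (↭-sym (shift u S (U ++ T))) perm
      tail : Linked R (u ∷ U) → Linked R U
      tail [-]          = []
      tail (_ ∷ linked) = linked
      sep′ : Separated (u ∷ S) T
      sep′ (here refl) = u-done
      sep′ (there x∈S) = sep x∈S

    step : (st : State) → length (State.S st) < t →
      Path n ⊎ Σ State λ st′ → potential st′ < potential st
    -- An empty stack and an empty T would mean S = L, too large.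
    step (state S [] [] perm _ _ _ _) S<t = ⊥-elim (<-irrefl refl (≤-trans S<t t≤S))
      where
      t≤S : t ≤ length S
      t≤S = begin
        t                   ≤⟨ ≤-trans (m≤m+n t n) (m≤m+n (t + n) m) ⟩
        t + n + m           ≤⟨ room ⟩
        length L            ≡⟨ sym (Partition.sizes S [] [] perm L!) ⟩
        length S + 0        ≡⟨ +-identityʳ (length S) ⟩
        length S            ∎
        where open ≤-Reasoning
    step (state S [] (w ∷ T) perm _ S-small U-small sep) _ =
      push S [] (w ∷ T) w T perm ↭-refl [-] S-small U-small sep
    step (state S (u ∷ U) T perm stack S-small U-small sep) S<t with any? (R? u) T
    ... | yes has-neighbour with extract has-neighbour
    ...   | w , T′ , Ruw , T↭ =
      push S (u ∷ U) T w T′ perm T↭ (R-sym Ruw ∷ stack) S-small U-small sep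
    step (state S (u ∷ U) T perm stack S-small U-small sep) S<t | no no-neighbour =
      inj₂ (pop S u U T perm stack S<t (≤-trans (n≤1+n _) U-small) sep
                (λ y∈T Ruy → no-neighbour (Any.map (λ { refl → Ruy }) y∈T)))

    search : (st : State) → Acc _<_ (potential st) → Path n ⊎ Split
    search st (acc smaller) with length (State.S st) ≟ t
    ... | yes full = inj₂ (finish st full)
    ... | no not-full with step st (≤∧≢⇒< (State.S-small st) not-full)
    ...   | inj₁ path = inj₁ path
    ...   | inj₂ (st′ , decrease) = search st′ (smaller decrease)

    dfs : Path n ⊎ Split
    dfs = search (state [] [] L ↭-refl [] z≤n z≤n (λ ())) (<-wellFounded _)

    T! : (split : Split) → Unique (Split.T split)
    T! split = Partition.T! S U T perm L! where open Split split

    first-block : ∀ {k} (split : Split) → Blocks k t (Split.T split) → Blocks (suc k) t L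
    first-block {k} split = extend-by (enumerate S! (≤-reflexive (sym S-size)))
      where
      open Split split
      open Partition S U T perm L!
      extend-by : Σ (Fin t → V) (λ s → Injective _≡_ _≡_ s × (∀ a → s a ∈ S)) →
        Blocks k t T → Blocks (suc k) t L
      extend-by (s , s-inj , s∈S) =
        extend s s-inj (S⊆L ∘ s∈S) T⊆L (λ a → S∩T=∅ (s∈S a)) (λ a → sep (s∈S a))

  open DepthFirstSearch using (dfs)

  -- Room for k + 2 blocks = room for one split plus room for k + 1 blocks.
  blocks-arithmetic : ∀ k n t → suc k * n + suc (suc k) * t ≡ t + n + (k * n + suc k * t)
  blocks-arithmetic = solve-∀

  blocks : (n t k : ℕ) (L : List V) → Unique L → k * n + suc k * t ≤ length L →
    Path n ⊎ Blocks (suc k) t L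
  blocks n t zero L L! room with enumerate L! (≤-trans (m≤m+n t 0) room)
  ... | s , s-inj , s∈L = inj₂ (extend s s-inj s∈L (λ ()) (λ _ ()) (λ _ ()) no-blocks)
  blocks n t (suc k) L L! room
    with dfs L L! t n (k * n + suc k * t) (subst (_≤ length L) (blocks-arithmetic k n t) room)
  ... | inj₁ path  = inj₁ path
  ... | inj₂ split =
    Sum.map₂ (first-block split) (blocks n t k (Split.T split) (T! split) (Split.T-size split))
    where open DepthFirstSearch L L! t n (k * n + suc k * t) _

module _ {N : ℕ} (G : Graph N) (c : Colouring G) where
  open Graph G
  open Colouring c

  Red : Fin N → Fin N → Set
  Red x y = adj x y ≡ true × col x y ≡ red

  is-red? : ∀ (k : Colour) → Dec (k ≡ red)
  is-red? red  = yes refl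
  is-red? blue = no (λ ())

  red? : ∀ x y → Dec (Red x y)
  red? x y = (adj x y Bool.≟ true) ×-dec is-red? (col x y)

  red-sym : ∀ {x y} → Red x y → Red y x
  red-sym {x} {y} (edge , colour) = trans (adj-sym y x) edge , trans (col-sym y x) colour

  not-red-blue : ∀ {x y} → adj x y ≡ true → ¬ Red x y → col x y ≡ blue
  not-red-blue {x} {y} edge not-red with col x y
  ... | red  = ⊥-elim (not-red (edge , refl))
  ... | blue = refl

proposition3p2 : (r t n : ℕ) → 2 ≤ r → 1 ≤ t → 1 ≤ n →
    (G : Graph (r * n + suc r * t)) (c : Colouring G) →
    RedPath G c n ⊎ BlueSets G c (suc r) t
proposition3p2 r t n _ _ _ G c
  with blocks n t r (allFin _) (allFin⁺ _) (≤-reflexive (sym (length-tabulate id)))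
  where open RedPathOrBlueBlocks (Red G c) (red? G c) (red-sym G c)
... | inj₁ red-path = inj₁ red-path
... | inj₂ (A , A-inj , _ , no-red) =
  inj₂ (A , A-inj , λ i j i<j a b edge → not-red-blue G c edge (no-red i j i<j a b))
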